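{- Let $\mathcal{E}$ be an edge-tangle in a graph $G$ and let $\overline{\mathcal{E}}$ be its conjugate. Let $X\subseteq E(G)$ and let $Y$ be the corresponding subset of $V(L(G))$. If $X$ is free with respect to $\mathcal{E}$, then $Y$ is free with respect to $\overline{\mathcal{E}}$.
   Context: Graphs are finite and may have loops and parallel edges. $L(G)$ is the line graph (simple graph on $E(G)$, distinct edges adjacent iff they share an end); $\mathrm{cl}(v)$ is the clique of edges incident with $v$. A separation of a graph $F$ is an ordered pair $(A,B)$ of edge-disjoint subgraphs with $A\cup B=F$, of order $|V(A)\cap V(B)|$. The normalization of $(A,B)$ is obtained by: first, for each non-isolated $v\in V(A)\cap V(B)$ all of whose neighbours in $A$ lie in $V(B)$, removing $v$ from $A$ and putting all edges incident with $v$ into $B$; second, moving all edges of $B$ with both ends in $V(A)\cap V(B)$ into $A$; finally, moving all isolated vertices of $B$ into $A$ (out of $B$). An edge-cut of $G$ is an ordered partition $[A,B]$ of $V(G)$ (parts may be empty), of order equal to the number of edges between $A$ and $B$. An edge-tangle of order $\theta$ in $G$ is a set $\mathcal{E}$ of edge-cuts of order less than $\theta$ with (E1) for every edge-cut $[A,B]$ of order less than $\theta$, $[A,B]\in\mathcal{E}$ or $[B,A]\in\mathcal{E}$; (E2) if $[A_i,B_i]\in\mathcal{E}$, $i=1,2,3$, then $B_1\cap B_2\cap B_3\ne\emptyset$; (E3) if $[A,B]\in\mathcal{E}$ then at least $\theta$ edges are incident with vertices of $B$. The partner of a normalized separation $(A,B)$ of $L(G)$ (one where each vertex of $V(A)\cap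 V(B)$ has a neighbour in $V(A)-V(B)$ and one in $V(B)-V(A)$) is the edge-cut $[A',B']$ with $A'$ the union of the isolated vertices of $G$ and $\{v:V(\mathrm{cl}(v))\subseteq V(A)\}$ and $B'=\{v:V(\mathrm{cl}(v))\subseteq V(B)\}$. If $\mathcal{E}$ has order $\theta$, its conjugate $\overline{\mathcal{E}}$ is the set of separations of $L(G)$ of order less than $\theta/3$ such that the partner of their normalization lies in $\mathcal{E}$. For $Z\subseteq E(G)$, $\mathcal{E}-Z$ is the set of edge-cuts of $G-Z$ ($G$ with $Z$ deleted) of order in $G-Z$ less than $\theta-|Z|$ that lie in $\mathcal{E}$. A set $Y$ of vertices is free with respect to a set $\mathcal{T}$ of separations if there is no $(A,B)\in\mathcal{T}$ of order less than $|Y|$ with $Y\subseteq V(A)$. A set $X\subseteq E(G)$ is free with respect to $\mathcal{E}$ if there exist no $Z\subseteq X$ and $[A,B]\in\mathcal{E}-Z$ of order less than $|X-Z|$ such that every edge of $X-Z$ has both ends in $A$. -}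

module Defs where

open import Data.Nat using (ℕ; zero; suc; _+_; _*_; _∸_; _<_; _≤_)
open import Data.Bool using (Bool; true; false; _∧_; _∨_; not; if_then_else_; _xor_)
open import Data.Fin using (Fin; zero; suc; _≟_)
open import Data.Product using (_×_; _,_; proj₁; proj₂; ∃)
open import Data.Sum using (_⊎_)
open import Data.Vec using (Vec; lookup; map)
open import Data.Fin.Subset using (Subset)
open import Relation.Nullary using (¬_)
open import Relation.Nullary.Decidable using (⌊_⌋)
open import Relation.Binary.PropositionalEquality using (_≡_)

-- Finite Boolean helpers (sets of Fin k are Bool-valued functions)

count : ∀ {k} → (Fin k → Bool) → ℕ
count {zero}  f = 0
count {suc k} f = (if f zero then 1 else 0) + count (λ i → f (suc i))

allᵇ : ∀ {k} → (Fin k → Bool) → Bool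
allᵇ {zero}  f = true
allᵇ {suc k} f = f zero ∧ allᵇ (λ i → f (suc i))

anyᵇ : ∀ {k} → (Fin k → Bool) → Bool
anyᵇ {zero}  f = false
anyᵇ {suc k} f = f zero ∨ anyᵇ (λ i → f (suc i))

_==_ : ∀ {k} → Fin k → Fin k → Bool
i == j = ⌊ i ≟ j ⌋

-- A (multi)graph G with vertex set Fin n and edge set Fin m; each edge
-- has two ends ι e (equal ends = loop; parallel edges allowed).

module _ {n m : ℕ} (ι : Fin m → Fin n × Fin n) where

  incident : Fin m → Fin n → Bool
  incident e v = (proj₁ (ι e) == v) ∨ (proj₂ (ι e) == v)

  isolatedG : Fin n → Bool
  isolatedG v = not (anyᵇ (λ e → incident e v))

  adjL : Fin m → Fin m → Bool
  adjL e f = not (e == f) ∧ anyᵇ (λ v → incident e v ∧ incident f v)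

  -- Separations (A,B) of L(G).  VA, VB are V(A), V(B); an edge {e,f} of
  -- L(G) belongs to A iff inA e f ≡ true, and to B otherwise (so A and B
  -- are edge-disjoint with A ∪ B = L(G)).

  record SepL : Set where
    field
      VA VB  : Fin m → Bool
      inA    : Fin m → Fin m → Bool
      inA-sym : ∀ e f → inA e f ≡ inA f e
      cover  : ∀ e → (VA e ∨ VB e) ≡ true
      A-ends : ∀ e f → adjL e f ≡ true → inA e f ≡ true → VA e ≡ true
      B-ends : ∀ e f → adjL e f ≡ true → inA e f ≡ false → VB e ≡ true

  orderSep : SepL → ℕ
  orderSep s = count (λ e → VA e ∧ VB e) where open SepL s

  module Norm (s : SepL) where
    open SepL s

    -- step 1: vertices moved out of A
    S1 : Fin m → Bool
    S1 v = anyᵇ (adjL v) ∧ VA v ∧ VB v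
           ∧ allᵇ (λ u → not (adjL v u ∧ inA v u) ∨ VB u)

    VA1 VB1 : Fin m → Bool
    VA1 v = VA v ∧ not (S1 v)
    VB1 v = VB v

    inA1 : Fin m → Fin m → Bool
    inA1 u v = inA u v ∧ not (S1 u) ∧ not (S1 v)

    -- step 2: edges of B with both ends in V(A)∩V(B) go into A
    inA2 : Fin m → Fin m → Bool
    inA2 u v = inA1 u v ∨ (VA1 u ∧ VB1 u ∧ VA1 v ∧ VB1 v)

    -- step 3: isolated vertices of B are moved into A (out of B)
    isoB2 : Fin m → Bool
    isoB2 v = allᵇ (λ u → not (adjL v u) ∨ inA2 v u)

    VA3 VB3 : Fin m → Bool
    VA3 v = VA1 v ∨ (VB1 v ∧ isoB2 v)
    VB3 v = VB1 v ∧ not (isoB2 v)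

    -- partner [A',B'] of the normalization (V(cl(x)) = edges incident with x)
    A′ B′ : Fin n → Bool
    A′ x = isolatedG x ∨ allᵇ (λ e → not (incident e x) ∨ VA3 e)
    B′ x = not (isolatedG x) ∧ allᵇ (λ e → not (incident e x) ∨ VB3 e)

  -- Edge-cuts [A,B]: a vector c with c[v] = true iff v ∈ A (B = rest).

  EdgeCut : Set
  EdgeCut = Subset n

  inB : EdgeCut → Fin n → Bool
  inB c v = not (lookup c v)

  crosses : EdgeCut → Fin m → Bool
  crosses c e = lookup c (proj₁ (ι e)) xor lookup c (proj₂ (ι e))

  -- order of the edge-cut in G − Z (Z ⊆ E(G)); Z = ∅ gives G itself
  orderCutMinus : (Fin m → Bool) → EdgeCut → ℕ
  orderCutMinus Z c = count (λ e → not (Z e) ∧ crosses c e)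

  orderCut : EdgeCut → ℕ
  orderCut = orderCutMinus (λ _ → false)

  record IsEdgeTangle (θ : ℕ) (ℰ : EdgeCut → Set) : Set where
    field
      E0 : ∀ c → ℰ c → orderCut c < θ
      E1 : ∀ c → orderCut c < θ → ℰ c ⊎ ℰ (map not c)
      E2 : ∀ c₁ c₂ c₃ → ℰ c₁ → ℰ c₂ → ℰ c₃ →
           ∃ λ v → (inB c₁ v ∧ inB c₂ v ∧ inB c₃ v) ≡ true
      E3 : ∀ c → ℰ c →
           θ ≤ count (λ e → inB c (proj₁ (ι e)) ∨ inB c (proj₂ (ι e)))

  conjugate : ℕ → (EdgeCut → Set) → SepL → Set
  conjugate θ ℰ s =
    (3 * orderSep s < θ) ×
    ((∀ x → Norm.B′ s x ≡ not (Norm.A′ s x)) ×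
     (∃ λ c → ℰ c × (∀ x → lookup c x ≡ Norm.A′ s x)))

  minusZ : ℕ → (EdgeCut → Set) → (Fin m → Bool) → EdgeCut → Set
  minusZ θ ℰ Z c = (orderCutMinus Z c < θ ∸ count Z) × ℰ c

  FreeEdges : ℕ → (EdgeCut → Set) → (Fin m → Bool) → Set
  FreeEdges θ ℰ X =
    ¬ (∃ λ (Z : Fin m → Bool) → (∀ e → Z e ≡ true → X e ≡ true) ×
        (∃ λ c → minusZ θ ℰ Z c ×
           (orderCutMinus Z c < count (λ e → X e ∧ not (Z e))) ×
           (∀ e → (X e ∧ not (Z e)) ≡ true →
              (lookup c (proj₁ (ι e)) ∧ lookup c (proj₂ (ι e))) ≡ true)))

  FreeVerts : (SepL → Set) → (Fin m → Bool) → Set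
  FreeVerts 𝒯 Y =
    ¬ (∃ λ s → 𝒯 s × (orderSep s < count Y) ×
         (∀ e → Y e ≡ true → SepL.VA s e ≡ true))

-- Let (A,B) be a separation in the conjugate of order k < |Y| with Y ⊆ V(A), and
-- [A',B'] ∈ ℰ the partner of its normalization.  Let Z be the edges of X that stay in
-- V(A) ∩ V(B) after normalizing.  Every other edge e of X ends up in V(A) − V(B), so
-- every edge sharing an end with e lies in V(A), i.e. both ends of e are in A'.  An
-- edge of G − Z crossing [A',B'] meets cl(x) ⊆ V(A) and cl(y) ⊆ V(B), so it lies in
-- V(A) ∩ V(B) − Z.  Hence the order of [A',B'] in G − Z is at most k − |Z|, which is
-- less than both |X − Z| and θ − |Z|: the cut [A',B'] ∈ ℰ − Z shows that X is not
-- free.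
module Submission where

open import Defs
open import Data.Nat using (ℕ; zero; suc; _+_; _*_; _∸_; _<_; _≤_; s≤s; z≤n)
open import Data.Nat.Properties
  using (m≤n⇒m≤1+n; +-suc; +-comm; +-cancelˡ-<; m+n≤o⇒m≤o∸n; m≤m+n; ≤-<-trans)
open import Data.Bool using (Bool; true; false; _∧_; _∨_; not; if_then_else_; _xor_)
open import Data.Bool.Properties using (∧-conicalˡ; ∧-conicalʳ)
open import Data.Fin using (Fin; zero; suc; _≟_)
open import Data.Product using (_×_; _,_; proj₁; proj₂; ∃)
open import Data.Sum using (_⊎_; inj₁; inj₂)
open import Data.Empty using (⊥)
open import Data.Vec using (lookup)
open import Relation.Nullary using (yes; no; contradiction)
open import Relation.Nullary.Decidable using (isYes≗does; dec-true; dec-false)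
open import Relation.Binary.PropositionalEquality
  using (_≡_; _≢_; refl; sym; trans; cong; cong₂; subst; subst₂)

∧-intro : ∀ {x y} → x ≡ true → y ≡ true → x ∧ y ≡ true
∧-intro refl refl = refl

∨-introˡ : ∀ {x} y → x ≡ true → x ∨ y ≡ true
∨-introˡ y refl = refl

∨-introʳ : ∀ x {y} → y ≡ true → x ∨ y ≡ true
∨-introʳ true  _ = refl
∨-introʳ false p = p

∨-elim : ∀ x y → x ∨ y ≡ true → x ≡ true ⊎ y ≡ true
∨-elim true  y _ = inj₁ refl
∨-elim false y p = inj₂ p

not-true : ∀ x → not x ≡ true → x ≡ false
not-true false _ = refl

not-false : ∀ x → not x ≡ false → x ≡ true
not-false true _ = refl

not-intro : ∀ {x} → x ≡ false → not x ≡ true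
not-intro refl = refl

true-or-false : ∀ x → x ≡ true ⊎ x ≡ false
true-or-false true  = inj₁ refl
true-or-false false = inj₂ refl

true≢false : ∀ {x} → x ≡ true → x ≡ false → ⊥
true≢false refl ()

implies-intro : ∀ x y → (x ≡ true → y ≡ true) → not x ∨ y ≡ true
implies-intro true  y h = h refl
implies-intro false y _ = refl

implies-elim : ∀ x y → not x ∨ y ≡ true → x ≡ true → y ≡ true
implies-elim true y p refl = p

xor-elim : ∀ x y → x xor y ≡ true → (x ≡ true × y ≡ false) ⊎ (x ≡ false × y ≡ true)
xor-elim true  false _ = inj₁ (refl , refl)
xor-elim false y     p = inj₂ (refl , p)

==-refl : ∀ {k} (i : Fin k) → i == i ≡ true
==-refl i = trans (isYes≗does (i ≟ i)) (dec-true (i ≟ i) refl)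

≢⇒==-false : ∀ {k} {i j : Fin k} → i ≢ j → i == j ≡ false
≢⇒==-false {i = i} {j} i≢j = trans (isYes≗does (i ≟ j)) (dec-false (i ≟ j) i≢j)

allᵇ-intro : ∀ {k} (g : Fin k → Bool) → (∀ i → g i ≡ true) → allᵇ g ≡ true
allᵇ-intro {zero}  g h = refl
allᵇ-intro {suc k} g h = ∧-intro (h zero) (allᵇ-intro (λ i → g (suc i)) (λ i → h (suc i)))

allᵇ-elim : ∀ {k} (g : Fin k → Bool) → allᵇ g ≡ true → ∀ i → g i ≡ true
allᵇ-elim {suc k} g p zero    = ∧-conicalˡ (g zero) _ p
allᵇ-elim {suc k} g p (suc i) = allᵇ-elim (λ i → g (suc i)) (∧-conicalʳ (g zero) _ p) i

anyᵇ-intro : ∀ {k} (g : Fin k → Bool) i → g i ≡ true → anyᵇ g ≡ true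
anyᵇ-intro {suc k} g zero    p = ∨-introˡ _ p
anyᵇ-intro {suc k} g (suc i) p = ∨-introʳ (g zero) (anyᵇ-intro (λ i → g (suc i)) i p)

anyᵇ-elim : ∀ {k} (g : Fin k → Bool) → anyᵇ g ≡ true → ∃ λ i → g i ≡ true
anyᵇ-elim {suc k} g p with ∨-elim (g zero) _ p
... | inj₁ q = zero , q
... | inj₂ q with anyᵇ-elim (λ i → g (suc i)) q
...   | i , r = suc i , r

count-mono : ∀ {k} (f g : Fin k → Bool) → (∀ i → f i ≡ true → g i ≡ true) →
             count f ≤ count g
count-mono {zero}  f g h = z≤n
count-mono {suc k} f g h with f zero | g zero | h zero
... | true  | true  | _ = s≤s (count-mono _ _ (λ i → h (suc i)))
... | true  | false | f⇒g = contradiction (f⇒g refl) λ ()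
... | false | true  | _ = m≤n⇒m≤1+n (count-mono _ _ (λ i → h (suc i)))
... | false | false | _ = count-mono _ _ (λ i → h (suc i))

count-cong : ∀ {k} (f g : Fin k → Bool) → (∀ i → f i ≡ g i) → count f ≡ count g
count-cong {zero}  f g h = refl
count-cong {suc k} f g h =
  cong₂ _+_ (cong (λ b → if b then 1 else 0) (h zero)) (count-cong _ _ (λ i → h (suc i)))

count-split : ∀ {k} (f Z : Fin k → Bool) →
              count f ≡ count (λ i → f i ∧ Z i) + count (λ i → f i ∧ not (Z i))
count-split {zero}  f Z = refl
count-split {suc k} f Z with f zero | Z zero | count-split (λ i → f (suc i)) (λ i → Z (suc i))
... | true  | true  | ih = cong suc ih
... | true  | false | ih = trans (cong suc ih) (sym (+-suc _ _))
... | false | true  | ih = ih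
... | false | false | ih = ih

count-split-⊆ : ∀ {k} (f Z : Fin k → Bool) → (∀ i → Z i ≡ true → f i ≡ true) →
                count f ≡ count Z + count (λ i → f i ∧ not (Z i))
count-split-⊆ f Z Z⊆f =
  trans (count-split f Z)
        (cong (_+ count (λ i → f i ∧ not (Z i))) (count-cong _ _ ∧-absorbs))
  where
  ∧-absorbs : ∀ i → f i ∧ Z i ≡ Z i
  ∧-absorbs i with Z i in eq
  ... | true  rewrite Z⊆f i eq = refl
  ... | false with f i
  ...   | true  = refl
  ...   | false = refl

module LineGraph {n m : ℕ} (ι : Fin m → Fin n × Fin n) where

  incident-proj₁ : ∀ e → incident ι e (proj₁ (ι e)) ≡ true
  incident-proj₁ e = ∨-introˡ _ (==-refl (proj₁ (ι e)))

  incident-proj₂ : ∀ e → incident ι e (proj₂ (ι e)) ≡ true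
  incident-proj₂ e = ∨-introʳ _ (==-refl (proj₂ (ι e)))

  incident⇒¬isolated : ∀ {e x} → incident ι e x ≡ true → isolatedG ι x ≡ false
  incident⇒¬isolated {e} {x} p with isolatedG ι x in eq
  ... | false = refl
  ... | true  = contradiction (anyᵇ-intro (λ f → incident ι f x) e p)
                              (λ q → true≢false q (not-true _ eq))

  adjL-intro : ∀ {e f} x → e ≢ f → incident ι e x ≡ true → incident ι f x ≡ true →
               adjL ι e f ≡ true
  adjL-intro {e} {f} x e≢f ex fx =
    ∧-intro (not-intro (≢⇒==-false e≢f))
            (anyᵇ-intro (λ v → incident ι e v ∧ incident ι f v) x (∧-intro ex fx))

  adjL-elim : ∀ e f → adjL ι e f ≡ true →
              e ≢ f × ∃ λ x → incident ι e x ≡ true × incident ι f x ≡ true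
  adjL-elim e f p with anyᵇ-elim (λ v → incident ι e v ∧ incident ι f v) (∧-conicalʳ _ _ p)
  ... | x , q = e≢f , x , ∧-conicalˡ _ _ q , ∧-conicalʳ _ _ q
    where
    e≢f : e ≢ f
    e≢f refl = true≢false (==-refl e) (not-true _ (∧-conicalˡ _ _ p))

  adjL-sym : ∀ e f → adjL ι e f ≡ true → adjL ι f e ≡ true
  adjL-sym e f p with adjL-elim e f p
  ... | e≢f , x , ex , fx = adjL-intro x (λ f≡e → e≢f (sym f≡e)) fx ex

module Normalization {n m : ℕ} (ι : Fin m → Fin n × Fin n) (s : SepL ι) where
  open SepL s
  open Norm ι s
  open LineGraph ι

  S1-elim : ∀ e → S1 e ≡ true →
            VB e ∧ allᵇ (λ u → not (adjL ι e u ∧ inA e u) ∨ VB u) ≡ true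
  S1-elim e p = ∧-conicalʳ (VA e) _ (∧-conicalʳ (anyᵇ (adjL ι e)) _ p)

  S1⇒VB : ∀ e → S1 e ≡ true → VB e ≡ true
  S1⇒VB e p = ∧-conicalˡ (VB e) _ (S1-elim e p)

  S1⇒A-neighbours-in-VB : ∀ e → S1 e ≡ true →
                          ∀ u → adjL ι e u ≡ true → inA e u ≡ true → VB u ≡ true
  S1⇒A-neighbours-in-VB e p u eu inA-eu =
    implies-elim (adjL ι e u ∧ inA e u) (VB u)
      (allᵇ-elim _ (∧-conicalʳ (VB e) _ (S1-elim e p)) u) (∧-intro eu inA-eu)

  normal-cover : ∀ e → VA3 e ∨ VB3 e ≡ true
  normal-cover e with true-or-false (VB e) | true-or-false (isoB2 e)
  ... | inj₁ vb  | inj₁ iso = ∨-introˡ (VB3 e) (∨-introʳ (VA1 e) (∧-intro vb iso))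
  ... | inj₁ vb  | inj₂ iso = ∨-introʳ (VA3 e) (∧-intro vb (not-intro iso))
  ... | inj₂ ¬vb | _ with ∨-elim (VA e) (VB e) (cover e) | true-or-false (S1 e)
  ...   | inj₂ vb | _        = contradiction ¬vb (true≢false vb)
  ...   | inj₁ _  | inj₁ s1  = contradiction ¬vb (true≢false (S1⇒VB e s1))
  ...   | inj₁ va | inj₂ ¬s1 =
    ∨-introˡ (VB3 e) (∨-introˡ (VB1 e ∧ isoB2 e) (∧-intro va (not-intro ¬s1)))

  normal-separator⊆separator : ∀ e → VA3 e ∧ VB3 e ≡ true → VA e ∧ VB e ≡ true
  normal-separator⊆separator e p with ∧-conicalˡ (VA3 e) _ p | ∧-conicalʳ (VA3 e) _ p
  ... | va3 | vb3 with ∨-elim (VA1 e) _ va3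
  ...   | inj₁ va1    = ∧-intro (∧-conicalˡ (VA e) _ va1) (∧-conicalˡ (VB e) _ vb3)
  ...   | inj₂ vb∧iso = contradiction (∧-conicalʳ (VB e) _ vb∧iso)
                          (λ iso → true≢false iso (not-true _ (∧-conicalʳ (VB e) _ vb3)))

  normal-B-ends : ∀ e f → adjL ι e f ≡ true → inA2 e f ≡ false → VB3 e ≡ true
  normal-B-ends e f ef ¬inA2 = ∧-intro vb (not-intro ¬iso)
    where
    ¬iso : isoB2 e ≡ false
    ¬iso with isoB2 e in iso
    ... | false = refl
    ... | true  = contradiction
                    (implies-elim (adjL ι e f) (inA2 e f)
                       (allᵇ-elim (λ u → not (adjL ι e u) ∨ inA2 e u) iso f) ef)
                    (λ inA2-ef → true≢false inA2-ef ¬inA2)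
    vb : VB e ≡ true
    vb with inA e f in inA-ef
    ... | false = B-ends e f ef inA-ef
    ... | true with not (S1 e) in ¬s1e | not (S1 f) in ¬s1f
    ...   | false | _    = S1⇒VB e (not-false _ ¬s1e)
    ...   | true  | false =
      S1⇒A-neighbours-in-VB f (not-false _ ¬s1f) e (adjL-sym e f ef) (trans (inA-sym f e) inA-ef)
    ...   | true  | true  = contradiction ¬inA2 λ ()

  normal-A-ends : ∀ e f → adjL ι e f ≡ true → inA2 e f ≡ true → VA3 f ≡ true
  normal-A-ends e f ef inA2-ef with ∨-elim (inA1 e f) _ inA2-ef
  ... | inj₂ both-separators =
    ∨-introˡ _ (∧-conicalˡ (VA1 f) _ (∧-conicalʳ (VB1 e) _ (∧-conicalʳ (VA1 e) _ both-separators)))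
  ... | inj₁ inA1-ef = ∨-introˡ _ (∧-intro va-f ¬s1f)
    where
    va-f : VA f ≡ true
    va-f = A-ends f e (adjL-sym e f ef) (trans (inA-sym f e) (∧-conicalˡ (inA e f) _ inA1-ef))
    ¬s1f : not (S1 f) ≡ true
    ¬s1f = ∧-conicalʳ (not (S1 e)) _ (∧-conicalʳ (inA e f) _ inA1-ef)

  normal-A-of-¬B : ∀ e → VB3 e ≡ false → VA3 e ≡ true
  normal-A-of-¬B e ¬vb3 with ∨-elim (VA3 e) (VB3 e) (normal-cover e)
  ... | inj₁ va3 = va3
  ... | inj₂ vb3 = contradiction ¬vb3 (true≢false vb3)

  normal-neighbours-of-¬B : ∀ e f → VB3 e ≡ false → adjL ι e f ≡ true → VA3 f ≡ true
  normal-neighbours-of-¬B e f ¬vb3 ef with true-or-false (inA2 e f)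
  ... | inj₁ inA2-ef  = normal-A-ends e f ef inA2-ef
  ... | inj₂ ¬inA2-ef = contradiction ¬vb3 (true≢false (normal-B-ends e f ef ¬inA2-ef))

  ends-of-¬B-in-A′ : ∀ e → VB3 e ≡ false → ∀ x → incident ι e x ≡ true → A′ x ≡ true
  ends-of-¬B-in-A′ e ¬vb3 x ex =
    ∨-introʳ (isolatedG ι x)
      (allᵇ-intro _ (λ f → implies-intro (incident ι f x) (VA3 f) (clique-in-VA3 f)))
    where
    clique-in-VA3 : ∀ f → incident ι f x ≡ true → VA3 f ≡ true
    clique-in-VA3 f fx with f ≟ e
    ... | yes refl = normal-A-of-¬B f ¬vb3
    ... | no f≢e   =
      normal-neighbours-of-¬B e f ¬vb3 (adjL-intro x (λ e≡f → f≢e (sym e≡f)) ex fx)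

  A′-clique-in-VA3 : ∀ {g x} → A′ x ≡ true → incident ι g x ≡ true → VA3 g ≡ true
  A′-clique-in-VA3 {g} {x} ax gx with ∨-elim (isolatedG ι x) _ ax
  ... | inj₁ iso = contradiction iso (λ iso′ → true≢false iso′ (incident⇒¬isolated gx))
  ... | inj₂ clique = implies-elim (incident ι g x) (VA3 g) (allᵇ-elim _ clique g) gx

  B′-clique-in-VB3 : ∀ {g y} → B′ y ≡ true → incident ι g y ≡ true → VB3 g ≡ true
  B′-clique-in-VB3 {g} {y} by gy =
    implies-elim (incident ι g y) (VB3 g)
      (allᵇ-elim _ (∧-conicalʳ (not (isolatedG ι y)) _ by) g) gy

  edge-from-A′-to-B′-in-separator : ∀ {g x y} → A′ x ≡ true → B′ y ≡ true →
    incident ι g x ≡ true → incident ι g y ≡ true → VA g ∧ VB g ≡ true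
  edge-from-A′-to-B′-in-separator {g} ax by gx gy =
    normal-separator⊆separator g (∧-intro (A′-clique-in-VA3 ax gx) (B′-clique-in-VB3 by gy))

module Partner {n m : ℕ} (ι : Fin m → Fin n × Fin n) (s : SepL ι) (c : EdgeCut ι)
               (B′≡¬A′ : ∀ x → Norm.B′ ι s x ≡ not (Norm.A′ ι s x))
               (c≡A′ : ∀ x → lookup c x ≡ Norm.A′ ι s x) where
  open SepL s
  open Norm ι s
  open LineGraph ι
  open Normalization ι s

  c⇒A′ : ∀ {x} → lookup c x ≡ true → A′ x ≡ true
  c⇒A′ {x} p = trans (sym (c≡A′ x)) p

  ¬c⇒B′ : ∀ {x} → lookup c x ≡ false → B′ x ≡ true
  ¬c⇒B′ {x} p = trans (B′≡¬A′ x) (not-intro (trans (sym (c≡A′ x)) p))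

  crossing-edge-in-separator : ∀ g → crosses ι c g ≡ true → VA g ∧ VB g ≡ true
  crossing-edge-in-separator g p with xor-elim (lookup c (proj₁ (ι g))) _ p
  ... | inj₁ (x∈c , y∉c) =
    edge-from-A′-to-B′-in-separator (c⇒A′ x∈c) (¬c⇒B′ y∉c) (incident-proj₁ g) (incident-proj₂ g)
  ... | inj₂ (x∉c , y∈c) =
    edge-from-A′-to-B′-in-separator (c⇒A′ y∈c) (¬c⇒B′ x∉c) (incident-proj₂ g) (incident-proj₁ g)

  ends-of-¬B-in-c : ∀ e → VB3 e ≡ false →
                    lookup c (proj₁ (ι e)) ∧ lookup c (proj₂ (ι e)) ≡ true
  ends-of-¬B-in-c e ¬vb3 =
    ∧-intro (trans (c≡A′ _) (ends-of-¬B-in-A′ e ¬vb3 _ (incident-proj₁ e)))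
            (trans (c≡A′ _) (ends-of-¬B-in-A′ e ¬vb3 _ (incident-proj₂ e)))

  order-minus-≤ : ∀ Z → orderCutMinus ι Z c ≤ count (λ e → (VA e ∧ VB e) ∧ not (Z e))
  order-minus-≤ Z = count-mono _ _ λ g p →
    ∧-intro (crossing-edge-in-separator g (∧-conicalʳ (not (Z g)) _ p))
            (∧-conicalˡ (not (Z g)) _ p)

  module Remainder (X : Fin m → Bool) (X⊆VA : ∀ e → X e ≡ true → VA e ≡ true) where

    Z : Fin m → Bool
    Z e = X e ∧ VB3 e

    Z⊆X : ∀ e → Z e ≡ true → X e ≡ true
    Z⊆X e = ∧-conicalˡ (X e) _

    Z⊆separator : ∀ e → Z e ≡ true → VA e ∧ VB e ≡ true
    Z⊆separator e p = ∧-intro (X⊆VA e (Z⊆X e p)) (∧-conicalˡ (VB e) _ (∧-conicalʳ (X e) _ p))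

    X−Z-inside-c : ∀ e → X e ∧ not (Z e) ≡ true →
                   lookup c (proj₁ (ι e)) ∧ lookup c (proj₂ (ι e)) ≡ true
    X−Z-inside-c e p = ends-of-¬B-in-c e
      (subst (λ b → b ∧ VB3 e ≡ false) (∧-conicalˡ (X e) _ p)
             (not-true (Z e) (∧-conicalʳ (X e) _ p)))

3*[m+n]<o⇒n<o∸m : ∀ m n {o} → 3 * (m + n) < o → n < o ∸ m
3*[m+n]<o⇒n<o∸m m n {o} 3k<o =
  m+n≤o⇒m≤o∸n (suc n) (subst (_< o) (+-comm m n) (≤-<-trans (m≤m+n (m + n) _) 3k<o))

lemma2p5 : {n m : ℕ} (ι : Fin m → Fin n × Fin n) (θ : ℕ)
           (ℰ : EdgeCut ι → Set) → IsEdgeTangle ι θ ℰ →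
           (X : Fin m → Bool) → FreeEdges ι θ ℰ X →
           FreeVerts ι (conjugate ι θ ℰ) X
lemma2p5 ι θ ℰ _ X X-free (s , (3k<θ , B′≡¬A′ , c , c∈ℰ , c≡A′) , k<|X| , X⊆VA) =
  X-free (Z , Z⊆X , c , (order<θ∸|Z| , c∈ℰ) , order<|X−Z| , X−Z-inside-c)
  where
  open SepL s
  open Partner ι s c B′≡¬A′ c≡A′
  open Remainder X X⊆VA

  k≡|Z|+a : orderSep ι s ≡ count Z + count (λ e → (VA e ∧ VB e) ∧ not (Z e))
  k≡|Z|+a = count-split-⊆ _ Z Z⊆separator

  a<|X−Z| : count (λ e → (VA e ∧ VB e) ∧ not (Z e)) < count (λ e → X e ∧ not (Z e))
  a<|X−Z| = +-cancelˡ-< (count Z) _ _ (subst₂ _<_ k≡|Z|+a (count-split-⊆ X Z Z⊆X) k<|X|)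

  order<|X−Z| : orderCutMinus ι Z c < count (λ e → X e ∧ not (Z e))
  order<|X−Z| = ≤-<-trans (order-minus-≤ Z) a<|X−Z|

  order<θ∸|Z| : orderCutMinus ι Z c < θ ∸ count Z
  order<θ∸|Z| = ≤-<-trans (order-minus-≤ Z)
    (3*[m+n]<o⇒n<o∸m (count Z) _ (subst (λ k → 3 * k < θ) k≡|Z|+a 3k<θ))
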